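{- Let $f_{\mathbb Q}:\mathbb F_{\hat p}\to{}^*\mathbb N$ be the function defined below. Then $f_{\mathbb Q}^{ -1}[\mathbb N]$ is (equal to the prime subfield of $\mathbb F_{\hat p}$, hence) isomorphic to $\mathbb Q$.
   Context: ${}^*\mathbb N=\mathbb N^I/\mathcal F$ is an ultrapower of $\mathbb N$ by a countably incomplete ultrafilter, with $\mathbb N\subseteq{}^*\mathbb N$ via constant sequences. $\hat p\in{}^*\mathbb N\setminus\mathbb N$ is a nonstandard prime (an element of ${}^*P$ for $P$ the set of primes) and $\mathbb F_{\hat p}=\{\hat n\in{}^*\mathbb N:\hat n<\hat p\}$ with operations modulo $\hat p$; it has characteristic $0$, and its prime subfield is identified with $\mathbb Q$. For $x\in\mathbb F_{\hat p}$, $f_{\mathbb Q}(x)$ is the minimum of $\max(n,m)$ over all $n,m\in{}^*\mathbb N$ with $m\not\equiv0\pmod{\hat p}$ and $x\equiv n/m$ or $x\equiv-n/m\pmod{\hat p}$; this is an internal function. -}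

module Defs where

open import Data.Nat using (ℕ; zero; suc; _+_; _*_; _<_; _≤_; _⊔_)
open import Data.Nat.DivMod using (_%_)
open import Data.Nat.Primality using (Prime)
open import Data.Integer as ℤ using (ℤ)
open import Data.Integer.DivMod as ℤD using ()
open import Data.Rational as ℚ using (ℚ)
open import Data.Product using (Σ; _×_; ∃; ∃-syntax; _,_)
open import Data.Sum using (_⊎_)
open import Data.Unit using (⊤)
open import Data.Empty using (⊥)
open import Relation.Nullary using (¬_)
open import Relation.Binary.PropositionalEquality using (_≡_; _≢_)
open import Function.Bundles using (_⇔_)

record Ultrafilter (I : Set) : Set₁ where
  field
    _∈F      : (I → Set) → Set
    full     : (λ _ → ⊤) ∈F
    proper   : ¬ ((λ _ → ⊥) ∈F)
    upward   : {A B : I → Set} → A ∈F → (∀ i → A i → B i) → B ∈F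
    inter    : {A B : I → Set} → A ∈F → B ∈F → (λ i → A i × B i) ∈F
    ultra    : (A : I → Set) → A ∈F ⊎ (λ i → ¬ A i) ∈F

open Ultrafilter public

CountablyIncomplete : {I : Set} → Ultrafilter I → Set₁
CountablyIncomplete {I} 𝓕 =
  Σ (ℕ → I → Set) λ X → (∀ n → (𝓕 ∈F) (X n)) × (∀ i → ¬ (∀ n → X n i))

-- Representatives of elements of the ultrapower *ℕ = ℕ^I / 𝓕.
*ℕ : Set → Set
*ℕ I = I → ℕ

module Ultrapower {I : Set} (𝓕 : Ultrafilter I) where

  AlmostAll : (I → Set) → Set
  AlmostAll A = (𝓕 ∈F) A

  _≈_ : *ℕ I → *ℕ I → Set
  x ≈ y = AlmostAll (λ i → x i ≡ y i)

  _<*_ : *ℕ I → *ℕ I → Set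
  x <* y = AlmostAll (λ i → x i < y i)

  const* : ℕ → *ℕ I
  const* n = λ _ → n

  Standard : *ℕ I → Set
  Standard x = ∃[ n ] (x ≈ const* n)

  NonstandardPrime : *ℕ I → Set
  NonstandardPrime p = AlmostAll (λ i → Prime (p i)) × ¬ Standard p

-- remainder, with a harmless convention for modulus 0
_mod_ : ℕ → ℕ → ℕ
a mod zero    = a
a mod (suc n) = a % suc n

CongZ : ℕ → ℤ → ℤ → Set
CongZ p a b = ∃[ k ] (a ℤ.- b ≡ k ℤ.* ℤ.+ p)

-- x ≡ n/m or x ≡ -n/m (mod p), with m ≢ 0 (mod p)
-- (division in 𝔽_p unfolded: x ≡ ±n/m  iff  x·m ≡ ±n  since m is invertible)
RepQ : ℕ → ℕ → ℕ → ℕ → Set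
RepQ p x n m =
  ¬ (m mod p ≡ 0) ×
  (CongZ p (ℤ.+ (x * m)) (ℤ.+ n) ⊎ CongZ p (ℤ.+ (x * m)) (ℤ.- (ℤ.+ n)))

IsMinQ : ℕ → ℕ → ℕ → Set
IsMinQ p x k =
  (∃[ n ] ∃[ m ] (RepQ p x n m × (n ⊔ m) ≡ k)) ×
  (∀ n m → RepQ p x n m → k ≤ n ⊔ m)

module PrimeField {I : Set} (𝓕 : Ultrafilter I) (p̂ : *ℕ I) where
  open Ultrapower 𝓕

  In𝔽 : *ℕ I → Set
  In𝔽 x = x <* p̂

  _+𝔽_ : *ℕ I → *ℕ I → *ℕ I
  (x +𝔽 y) i = (x i + y i) mod p̂ i

  _*𝔽_ : *ℕ I → *ℕ I → *ℕ I
  (x *𝔽 y) i = (x i * y i) mod p̂ i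

  0𝔽 : *ℕ I
  0𝔽 = const* 0

  1𝔽 : *ℕ I
  1𝔽 = const* 1

  -- the internal function f_ℚ, given pointwise by a standard function g with
  -- g p x = min { max(n,m) : x ≡ ±n/m (mod p), m ≢ 0 (mod p) } for p prime, x < p
  fQ : (ℕ → ℕ → ℕ) → *ℕ I → *ℕ I
  fQ g x i = g (p̂ i) (x i)

{-# OPTIONS --safe #-}
-- Let φ send q = a/b to the residue of a·b⁻¹ modulo p̂ᵢ, coordinatewise. An identity
-- between finitely many fixed rationals holds modulo every prime that divides none of their
-- denominators, and for almost all i the nonstandard p̂ᵢ exceeds any fixed number; this gives the
-- ring laws, and injectivity because a fixed integer divisible by almost all p̂ᵢ is 0.
-- If x = φ(±n/m), then ±n/m itself witnesses f_ℚ(x) ≤ max(n, m) almost everywhere, and an element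
-- of *ℕ that is bounded almost everywhere is standard (finitely many values, one of which is taken
-- almost everywhere). Conversely, if f_ℚ(x) = k is standard, then almost every xᵢ is ±n/m with
-- n, m ≤ k; one choice of n, m and sign works almost everywhere, and then x = φ(±n/m).

module Submission where

open import Defs
open import Data.Nat as ℕ using (ℕ; zero; suc; _<_; _≤_; _⊔_; s≤s; NonZero; nonTrivial⇒n>1)
import Data.Nat.Properties as ℕP
open import Data.Nat.DivMod using (_%_; m%n<n)
open import Data.Nat.Divisibility using (_∣_; _∤_; ∣-refl; >⇒∤; m%n≡0⇒n∣m)
open import Data.Nat.Primality using (Prime; euclidsLemma; prime⇒irreducible; prime⇒nonTrivial)
open import Data.Nat.Coprimality using (Coprime; coprime⇒GCD≡1)
open import Data.Nat.GCD using (module GCD; module Bézout)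
open import Data.Integer as ℤ using (ℤ; +_; -[1+_]; ∣_∣; 0ℤ; 1ℤ; _+_; _*_; _-_; -_)
import Data.Integer.Properties as ℤP
open import Data.Integer.DivMod using (_%ℕ_; _/ℕ_; a≡a%ℕn+[a/ℕn]*n; n%ℕd<d)
open import Data.Integer.Divisibility.Signed as ℤ∣
  using (∣ᵤ⇒∣; ∣⇒∣ᵤ; ∣m∣n⇒∣m+n; ∣m∣n⇒∣m-n; ∣n⇒∣m*n)
import Data.Integer.Coprimality as ℤC
open import Data.Integer.Tactic.RingSolver using (solve-∀)
open import Data.Rational as ℚ using (ℚ; toℚᵘ; fromℚᵘ)
import Data.Rational.Properties as ℚP
open import Data.Rational.Unnormalised as ℚᵘ using (ℚᵘ; mkℚᵘ; *≡*; ↥_; ↧_; ↧ₙ_; _≃_)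
import Data.Rational.Unnormalised.Properties as ℚᵘP
open import Data.Product using (Σ; _×_; ∃-syntax; _,_)
open import Data.Sum as Sum using (_⊎_; inj₁; inj₂; [_,_])
open import Data.Empty using (⊥-elim)
open import Function using (_∘_; id)
open import Function.Bundles using (_⇔_; mk⇔)
open import Relation.Nullary using (¬_; Dec; yes; no; contradiction)
open import Relation.Binary.PropositionalEquality
  using (_≡_; refl; sym; trans; cong; cong₂; subst; module ≡-Reasoning)

private variable
  d k m n p x y : ℕ
  a b z : ℤ
  u v w : ℚᵘ

prime>1 : Prime p → 1 < p
prime>1 {p = p} p-prime = nonTrivial⇒n>1 p {{prime⇒nonTrivial p-prime}}

prime∤⇒coprime : Prime p → p ∤ n → Coprime p n
prime∤⇒coprime p-prime p∤n (d∣p , d∣n) with prime⇒irreducible p-prime d∣p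
... | inj₁ d≡1 = d≡1
... | inj₂ refl = contradiction d∣n p∤n

prime∤-* : Prime p → p ∤ m → p ∤ n → p ∤ m ℕ.* n
prime∤-* {m = m} {n = n} p-prime p∤m p∤n = [ p∤m , p∤n ] ∘ euclidsLemma m n p-prime

mod< : Prime p → x mod p < p
mod< {p = suc _} {x = x} _ = m%n<n x _

mod≡0⇒∣ : m mod p ≡ 0 → p ∣ m
mod≡0⇒∣ {p = zero}          refl  = ∣-refl
mod≡0⇒∣ {m = m} {p = suc _} m%p≡0 = m%n≡0⇒n∣m m _ m%p≡0

infix 4 _≡_mod[_]

_≡_mod[_] : ℤ → ℤ → ℕ → Set
a ≡ b mod[ p ] = + p ℤ∣.∣ a - b

≡⇒≡mod : a ≡ b → a ≡ b mod[ p ]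
≡⇒≡mod {a = a} refl = ℤ∣.divides 0ℤ (ℤP.+-inverseʳ a)

prime∤-cancelˡ : Prime p → p ∤ d → + p ℤ∣.∣ + d * z → + p ℤ∣.∣ z
prime∤-cancelˡ {d = d} {z = z} p-prime p∤d =
  ∣ᵤ⇒∣ ∘ ℤC.coprime-divisor (+ _) (+ d) z (prime∤⇒coprime p-prime p∤d) ∘ ∣⇒∣ᵤ

≡mod⇒≡ : a ≡ b mod[ p ] → ∣ a - b ∣ < p → a ≡ b
≡mod⇒≡ {a = a} {b = b} p∣a-b small with ∣ a - b ∣ in eq
... | zero  = ℤP.i-j≡0⇒i≡j a b (ℤP.∣i∣≡0⇒i≡0 eq)
... | suc _ = contradiction (subst (_ ∣_) eq (∣⇒∣ᵤ p∣a-b)) (>⇒∤ small)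

≡mod-<⇒≡ : + x ≡ + y mod[ p ] → x < p → y < p → x ≡ y
≡mod-<⇒≡ {x = x} {y = y} {p = p} x≡y x<p y<p = ℤP.+-injective (≡mod⇒≡ x≡y ∣x-y∣<p)
  where
  ∣x-y∣<p : ∣ + x - + y ∣ < p
  ∣x-y∣<p = subst (λ w → ∣ w ∣ < _) (sym (ℤP.m-n≡m⊖n x y))
              (ℕP.≤-<-trans (ℤP.∣m⊝n∣≤m⊔n x y) (ℕP.⊔-lub x<p y<p))

pos-1+*≡* : ∀ a b c e → 1 ℕ.+ a ℕ.* b ≡ c ℕ.* e → 1ℤ + + a * + b ≡ + c * + e
pos-1+*≡* a b c e eq =
  trans (cong (λ w → 1ℤ + w) (sym (ℤP.pos-* a b))) (trans (cong +_ eq) (ℤP.pos-* c e))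

%ℕ-≡mod : .{{_ : NonZero p}} → + (z %ℕ p) ≡ z mod[ p ]
%ℕ-≡mod {p = p} {z = z} = ℤ∣.divides (- (z /ℕ p)) z%p≡z+qp
  where
  identity : ∀ r k q → r - (r + k * q) ≡ - k * q
  identity = solve-∀
  z%p≡z+qp : + (z %ℕ p) - z ≡ - (z /ℕ p) * + p
  z%p≡z+qp = trans (cong (λ w → + (z %ℕ p) - w) (a≡a%ℕn+[a/ℕn]*n z p))
                   (identity (+ (z %ℕ p)) (z /ℕ p) (+ p))

infix 4 _≡ᵘ_mod[_]

data _≡ᵘ_mod[_] (x : ℕ) (u : ℚᵘ) (p : ℕ) : Set where
  *≡↥ : + x * ↧ u ≡ ↥ u mod[ p ] → x ≡ᵘ u mod[ p ]

≡ᵘ-unique : Prime p → p ∤ ↧ₙ u → x < p → y < p → x ≡ᵘ u mod[ p ] → y ≡ᵘ u mod[ p ] → x ≡ y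
≡ᵘ-unique {u = u} {x = x} {y = y} p-prime p∤u x<p y<p (*≡↥ x≡u) (*≡↥ y≡u) =
  ≡mod-<⇒≡ (prime∤-cancelˡ p-prime p∤u
             (subst (_ ℤ∣.∣_) (identity (+ x) (+ y) (↧ u) (↥ u)) (∣m∣n⇒∣m-n x≡u y≡u)))
           x<p y<p
  where
  identity : ∀ x y d n → (x * d - n) - (y * d - n) ≡ d * (x - y)
  identity = solve-∀

≡ᵘ-resp-≃ : Prime p → p ∤ ↧ₙ u → u ≃ v → x ≡ᵘ u mod[ p ] → x ≡ᵘ v mod[ p ]
≡ᵘ-resp-≃ {u = u} {v = v} {x = x} p-prime p∤u (*≡* cross) (*≡↥ x≡u) = *≡↥ (
  prime∤-cancelˡ p-prime p∤u
    (subst (_ ℤ∣.∣_) (identity (+ x) (↧ u) (↧ v) (↥ u) (↥ v))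
      (∣m∣n⇒∣m+n (∣n⇒∣m*n (↧ v) x≡u) (≡⇒≡mod cross))))
  where
  identity : ∀ x du dv nu nv → dv * (x * du - nu) + (nu * dv - nv * du) ≡ du * (x * dv - nv)
  identity = solve-∀

≡ᵘ-cross : x ≡ᵘ u mod[ p ] → x ≡ᵘ v mod[ p ] → ↥ u * ↧ v ≡ ↥ v * ↧ u mod[ p ]
≡ᵘ-cross {x = x} {u = u} {v = v} (*≡↥ x≡u) (*≡↥ x≡v) =
  subst (_ ℤ∣.∣_) (identity (+ x) (↧ u) (↧ v) (↥ u) (↥ v))
    (∣m∣n⇒∣m-n (∣n⇒∣m*n (↧ u) x≡v) (∣n⇒∣m*n (↧ v) x≡u))
  where
  identity : ∀ x du dv nu nv → du * (x * dv - nv) - dv * (x * du - nu) ≡ nu * dv - nv * du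
  identity = solve-∀

-- Matching on mkℚᵘ lets u ℚᵘ.+ v compute, so that its denominator is ↧ₙ u ℕ.* ↧ₙ v.
≡ᵘ-+ : x ≡ᵘ u mod[ p ] → y ≡ᵘ v mod[ p ] → x ℕ.+ y ≡ᵘ u ℚᵘ.+ v mod[ p ]
≡ᵘ-+ {x = x} {u = u@(mkℚᵘ _ _)} {y = y} {v = v@(mkℚᵘ _ _)} (*≡↥ x≡u) (*≡↥ y≡v) = *≡↥ (
  subst (_ ℤ∣.∣_) (sym (trans casts (identity (+ x) (+ y) (↧ u) (↧ v) (↥ u) (↥ v))))
    (∣m∣n⇒∣m+n (∣n⇒∣m*n (↧ v) x≡u) (∣n⇒∣m*n (↧ u) y≡v)))
  where
  casts : + (x ℕ.+ y) * ↧ (u ℚᵘ.+ v) - ↥ (u ℚᵘ.+ v) ≡ (+ x + + y) * (↧ u * ↧ v) - ↥ (u ℚᵘ.+ v)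
  casts = cong₂ (λ s d → s * d - ↥ (u ℚᵘ.+ v)) (ℤP.pos-+ x y) (ℤP.pos-* (↧ₙ u) (↧ₙ v))
  identity : ∀ x y du dv nu nv →
             (x + y) * (du * dv) - (nu * dv + nv * du) ≡ dv * (x * du - nu) + du * (y * dv - nv)
  identity = solve-∀

≡ᵘ-* : x ≡ᵘ u mod[ p ] → y ≡ᵘ v mod[ p ] → x ℕ.* y ≡ᵘ u ℚᵘ.* v mod[ p ]
≡ᵘ-* {x = x} {u = u@(mkℚᵘ _ _)} {y = y} {v = v@(mkℚᵘ _ _)} (*≡↥ x≡u) (*≡↥ y≡v) = *≡↥ (
  subst (_ ℤ∣.∣_) (sym (trans casts (identity (+ x) (+ y) (↧ u) (↧ v) (↥ u) (↥ v))))
    (∣m∣n⇒∣m+n (∣n⇒∣m*n (+ y * ↧ v) x≡u) (∣n⇒∣m*n (↥ u) y≡v)))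
  where
  casts : + (x ℕ.* y) * ↧ (u ℚᵘ.* v) - ↥ (u ℚᵘ.* v) ≡ (+ x * + y) * (↧ u * ↧ v) - ↥ u * ↥ v
  casts = cong₂ (λ s d → s * d - ↥ u * ↥ v) (ℤP.pos-* x y) (ℤP.pos-* (↧ₙ u) (↧ₙ v))
  identity : ∀ x y du dv nu nv →
             (x * y) * (du * dv) - nu * nv ≡ (y * dv) * (x * du - nu) + nu * (y * dv - nv)
  identity = solve-∀

≡ᵘ-mod : x ≡ᵘ u mod[ p ] → x mod p ≡ᵘ u mod[ p ]
≡ᵘ-mod {p = zero} x≡u = x≡u
≡ᵘ-mod {x = x} {u = u} {p = suc _} (*≡↥ x≡u) = *≡↥ (
  subst (_ ℤ∣.∣_) (identity (+ (x % _)) (+ x) (↧ u) (↥ u))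
    (∣m∣n⇒∣m+n (∣n⇒∣m*n (↧ u) (%ℕ-≡mod {z = + x})) x≡u))
  where
  identity : ∀ r x d n → d * (r - x) + (x * d - n) ≡ r * d - n
  identity = solve-∀

-- The coefficient of d in a Bézout identity for p and d: an inverse of d modulo p when they are coprime.
inverse : ℕ → ℕ → ℤ
inverse p d with Bézout.lemma p d
... | Bézout.result _ _ (Bézout.+- _ y _) = - + y
... | Bézout.result _ _ (Bézout.-+ _ y _) = + y

inverse-correct : Prime p → p ∤ d → inverse p d * + d ≡ 1ℤ mod[ p ]
inverse-correct {p = p} {d = d} p-prime p∤d with Bézout.lemma p d
... | Bézout.result g g-gcd bézout
    with refl ← GCD.unique g-gcd (coprime⇒GCD≡1 (prime∤⇒coprime p-prime p∤d))
    with bézout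
... | Bézout.+- x y 1+yd≡xp = ℤ∣.divides (- + x) (begin
  - + y * + d - 1ℤ    ≡⟨ identity (+ y) (+ d) ⟩
  - (1ℤ + + y * + d)  ≡⟨ cong -_ (pos-1+*≡* y d x p 1+yd≡xp) ⟩
  - (+ x * + p)       ≡⟨ ℤP.neg-distribˡ-* (+ x) (+ p) ⟩
  - + x * + p         ∎)
  where
  open ≡-Reasoning
  identity : ∀ y d → - y * d - 1ℤ ≡ - (1ℤ + y * d)
  identity = solve-∀
... | Bézout.-+ x y 1+xp≡yd = ℤ∣.divides (+ x) (begin
  + y * + d - 1ℤ             ≡⟨ cong (_- 1ℤ) (sym (pos-1+*≡* x p y d 1+xp≡yd)) ⟩
  (1ℤ + + x * + p) - 1ℤ      ≡⟨ identity (+ x * + p) ⟩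
  + x * + p                  ∎)
  where
  open ≡-Reasoning
  identity : ∀ a → (1ℤ + a) - 1ℤ ≡ a
  identity = solve-∀

residue : ℕ → ℚᵘ → ℕ
residue zero      _ = 0
residue p@(suc _) u = (↥ u * inverse p (↧ₙ u)) %ℕ p

residue< : Prime p → residue p u < p
residue< {p = p@(suc _)} {u = u} _ = n%ℕd<d (↥ u * inverse p (↧ₙ u)) p

residue-≡ᵘ : Prime p → p ∤ ↧ₙ u → residue p u ≡ᵘ u mod[ p ]
residue-≡ᵘ {p = p@(suc _)} {u = u} p-prime p∤u = *≡↥ (
  subst (_ ℤ∣.∣_) (identity (+ residue p u) (↧ u) (↥ u) (inverse p (↧ₙ u)))
    (∣m∣n⇒∣m+n (∣n⇒∣m*n (↧ u) (%ℕ-≡mod {z = ↥ u * inverse p (↧ₙ u)}))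
               (∣n⇒∣m*n (↥ u) (inverse-correct p-prime p∤u))))
  where
  identity : ∀ r d n i → d * (r - n * i) + n * (i * d - 1ℤ) ≡ r * d - n
  identity = solve-∀

residue-unique : Prime p → p ∤ ↧ₙ u → p ∤ ↧ₙ v → u ≃ v →
                 x < p → x ≡ᵘ u mod[ p ] → residue p v ≡ x
residue-unique p-prime p∤u p∤v u≃v x<p x≡u =
  ≡ᵘ-unique p-prime p∤v (residue< p-prime) x<p (residue-≡ᵘ p-prime p∤v)
    (≡ᵘ-resp-≃ p-prime p∤u u≃v x≡u)

residue-+ : Prime p → p ∤ ↧ₙ u → p ∤ ↧ₙ v → p ∤ ↧ₙ w → u ℚᵘ.+ v ≃ w →
            residue p w ≡ (residue p u ℕ.+ residue p v) mod p
residue-+ {u = mkℚᵘ _ _} {v = mkℚᵘ _ _} p-prime p∤u p∤v p∤w u+v≃w =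
  residue-unique p-prime (prime∤-* p-prime p∤u p∤v) p∤w u+v≃w (mod< p-prime)
    (≡ᵘ-mod (≡ᵘ-+ (residue-≡ᵘ p-prime p∤u) (residue-≡ᵘ p-prime p∤v)))

residue-* : Prime p → p ∤ ↧ₙ u → p ∤ ↧ₙ v → p ∤ ↧ₙ w → u ℚᵘ.* v ≃ w →
            residue p w ≡ (residue p u ℕ.* residue p v) mod p
residue-* {u = mkℚᵘ _ _} {v = mkℚᵘ _ _} p-prime p∤u p∤v p∤w u*v≃w =
  residue-unique p-prime (prime∤-* p-prime p∤u p∤v) p∤w u*v≃w (mod< p-prime)
    (≡ᵘ-mod (≡ᵘ-* (residue-≡ᵘ p-prime p∤u) (residue-≡ᵘ p-prime p∤v)))

CongZ⇒≡ᵘ : (s : ℤ) → CongZ p (+ (x ℕ.* suc d)) s → x ≡ᵘ mkℚᵘ s d mod[ p ]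
CongZ⇒≡ᵘ {x = x} {d = d} _ (k , eq) =
  *≡↥ (ℤ∣.divides k (trans (cong (_- _) (sym (ℤP.pos-* x (suc d)))) eq))

≡ᵘ⇒CongZ : x ≡ᵘ u mod[ p ] → CongZ p (+ (x ℕ.* ↧ₙ u)) (↥ u)
≡ᵘ⇒CongZ {x = x} {u = u} (*≡↥ (ℤ∣.divides k eq)) =
  k , trans (cong (_- ↥ u) (ℤP.pos-* x (↧ₙ u))) eq

≡ᵘ⇒RepQ : p ∤ ↧ₙ u → x ≡ᵘ u mod[ p ] → RepQ p x ∣ ↥ u ∣ (↧ₙ u)
≡ᵘ⇒RepQ {u = mkℚᵘ (+ _)    _} p∤u x≡u = p∤u ∘ mod≡0⇒∣ , inj₁ (≡ᵘ⇒CongZ x≡u)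
≡ᵘ⇒RepQ {u = mkℚᵘ -[1+ _ ] _} p∤u x≡u = p∤u ∘ mod≡0⇒∣ , inj₂ (≡ᵘ⇒CongZ x≡u)

RepQ⇒≡ᵘ : RepQ p x n (suc d) → x ≡ᵘ mkℚᵘ (+ n) d mod[ p ] ⊎ x ≡ᵘ mkℚᵘ (- + n) d mod[ p ]
RepQ⇒≡ᵘ (_ , x≡±n/m) = Sum.map (CongZ⇒≡ᵘ _) (CongZ⇒≡ᵘ _) x≡±n/m

¬RepQ[0] : ¬ RepQ p x n 0
¬RepQ[0] {p = zero}  (0≢0 , _) = 0≢0 refl
¬RepQ[0] {p = suc _} (0≢0 , _) = 0≢0 refl

IsMinQ-≤ : IsMinQ p x k → p ∤ ↧ₙ u → x ≡ᵘ u mod[ p ] → k ≤ ∣ ↥ u ∣ ⊔ ↧ₙ u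
IsMinQ-≤ (_ , minimal) p∤u x≡u = minimal _ _ (≡ᵘ⇒RepQ p∤u x≡u)

IsMinQ⇒bounded-RepQ : IsMinQ p x k → ∃[ n ] (n < suc k × ∃[ m ] (m < suc k × RepQ p x n m))
IsMinQ⇒bounded-RepQ ((n , m , rep , refl) , _) =
  n , s≤s (ℕP.m≤m⊔n n m) , m , s≤s (ℕP.m≤n⊔m n m) , rep

module _ {I : Set} (𝓕 : Ultrafilter I) where
  open Ultrapower 𝓕

  almostAll-⊎ : {A B : I → Set} → AlmostAll (λ i → A i ⊎ B i) → AlmostAll A ⊎ AlmostAll B
  almostAll-⊎ {A} a⊎b with ultra 𝓕 A
  ... | inj₁ a  = inj₁ a
  ... | inj₂ ¬a = inj₂ (upward 𝓕 (inter 𝓕 a⊎b ¬a) λ _ (a⊎bᵢ , ¬aᵢ) → [ ⊥-elim ∘ ¬aᵢ , id ] a⊎bᵢ)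

  almostAll-const : {P : Set} → Dec P → AlmostAll (λ _ → P) → P
  almostAll-const (yes p) _  = p
  almostAll-const (no ¬p) ap = ⊥-elim (proper 𝓕 (upward 𝓕 ap λ _ → ¬p))

  pigeonhole : (B : ℕ → I → Set) (N : ℕ) →
               AlmostAll (λ i → ∃[ j ] (j < N × B j i)) → ∃[ j ] AlmostAll (B j)
  pigeonhole B zero    some = ⊥-elim (proper 𝓕 (upward 𝓕 some λ _ (_ , j<0 , _) → ℕP.n≮0 j<0))
  pigeonhole B (suc N) some with almostAll-⊎ (upward 𝓕 some split)
    where
    split : ∀ i → ∃[ j ] (j < suc N × B j i) → B N i ⊎ ∃[ j ] (j < N × B j i)
    split i (j , j<1+N , bj) with ℕP.m<1+n⇒m<n∨m≡n j<1+N
    ... | inj₁ j<N  = inj₂ (j , j<N , bj)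
    ... | inj₂ refl = inj₁ bj
  ... | inj₁ bN   = N , bN
  ... | inj₂ rest = pigeonhole B N rest

  bounded⇒standard : {y : *ℕ I} (N : ℕ) → AlmostAll (λ i → y i ≤ N) → Standard y
  bounded⇒standard {y} N y≤N =
    pigeonhole (λ j i → y i ≡ j) (suc N) (upward 𝓕 y≤N λ i yᵢ≤N → y i , s≤s yᵢ≤N , refl)

  nonstandard⇒large : {y : *ℕ I} → ¬ Standard y → ∀ N → AlmostAll (λ i → N < y i)
  nonstandard⇒large {y} y-nonstandard N with ultra 𝓕 (λ i → N < y i)
  ... | inj₁ large = large
  ... | inj₂ small = ⊥-elim (y-nonstandard (bounded⇒standard N (upward 𝓕 small λ _ → ℕP.≮⇒≥)))

module Embedding {I : Set} (𝓕 : Ultrafilter I) (p̂ : *ℕ I)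
                 (p̂-prime : Ultrapower.AlmostAll 𝓕 (λ i → Prime (p̂ i)))
                 (p̂-nonstandard : ¬ Ultrapower.Standard 𝓕 p̂) where
  open Ultrapower 𝓕
  open PrimeField 𝓕 p̂

  φ : ℚ → *ℕ I
  φ q i = residue (p̂ i) (toℚᵘ q)

  prime∤ : ∀ d .{{_ : NonZero d}} → AlmostAll (λ i → Prime (p̂ i) × p̂ i ∤ d)
  prime∤ d = upward 𝓕 (inter 𝓕 p̂-prime (nonstandard⇒large 𝓕 p̂-nonstandard d))
    λ _ (pᵢ-prime , d<pᵢ) → pᵢ-prime , >⇒∤ d<pᵢ

  φ-∈𝔽 : ∀ q → In𝔽 (φ q)
  φ-∈𝔽 q = upward 𝓕 p̂-prime λ _ → residue<

  φ-0 : φ ℚ.0ℚ ≈ 0𝔽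
  φ-0 = upward 𝓕 (prime∤ 1) λ _ (pᵢ-prime , pᵢ∤1) →
    residue-unique pᵢ-prime pᵢ∤1 pᵢ∤1 ℚᵘP.≃-refl (ℕP.<⇒≤ (prime>1 pᵢ-prime))
      (*≡↥ (≡⇒≡mod {a = 0ℤ} refl))

  φ-1 : φ ℚ.1ℚ ≈ 1𝔽
  φ-1 = upward 𝓕 (prime∤ 1) λ _ (pᵢ-prime , pᵢ∤1) →
    residue-unique pᵢ-prime pᵢ∤1 pᵢ∤1 ℚᵘP.≃-refl (prime>1 pᵢ-prime)
      (*≡↥ (≡⇒≡mod {a = 1ℤ} refl))

  φ-+ : ∀ q r → φ (q ℚ.+ r) ≈ (φ q +𝔽 φ r)
  φ-+ q r =
    upward 𝓕 (inter 𝓕 (prime∤ (↧ₙ toℚᵘ q))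
                (inter 𝓕 (prime∤ (↧ₙ toℚᵘ r)) (prime∤ (↧ₙ toℚᵘ (q ℚ.+ r)))))
    λ _ ((pᵢ-prime , pᵢ∤q) , (_ , pᵢ∤r) , (_ , pᵢ∤q+r)) →
      residue-+ pᵢ-prime pᵢ∤q pᵢ∤r pᵢ∤q+r (ℚᵘP.≃-sym (ℚP.toℚᵘ-homo-+ q r))

  φ-* : ∀ q r → φ (q ℚ.* r) ≈ (φ q *𝔽 φ r)
  φ-* q r =
    upward 𝓕 (inter 𝓕 (prime∤ (↧ₙ toℚᵘ q))
                (inter 𝓕 (prime∤ (↧ₙ toℚᵘ r)) (prime∤ (↧ₙ toℚᵘ (q ℚ.* r)))))
    λ _ ((pᵢ-prime , pᵢ∤q) , (_ , pᵢ∤r) , (_ , pᵢ∤q*r)) →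
      residue-* pᵢ-prime pᵢ∤q pᵢ∤r pᵢ∤q*r (ℚᵘP.≃-sym (ℚP.toℚᵘ-homo-* q r))

  φ-injective : ∀ q r → φ q ≈ φ r → q ≡ r
  φ-injective q r φq≈φr = ℚP.toℚᵘ-injective (*≡* (almostAll-const 𝓕 (_ ℤ.≟ _) cross-equal))
    where
    qᵘ rᵘ : ℚᵘ
    qᵘ = toℚᵘ q
    rᵘ = toℚᵘ r
    cross-equal : AlmostAll (λ _ → ↥ qᵘ * ↧ rᵘ ≡ ↥ rᵘ * ↧ qᵘ)
    cross-equal = upward 𝓕 (inter 𝓕 φq≈φr (inter 𝓕 (prime∤ (↧ₙ qᵘ)) (inter 𝓕 (prime∤ (↧ₙ rᵘ))
                    (nonstandard⇒large 𝓕 p̂-nonstandard ∣ ↥ qᵘ * ↧ rᵘ - ↥ rᵘ * ↧ qᵘ ∣))))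
      λ _ (φqᵢ≡φrᵢ , (pᵢ-prime , pᵢ∤q) , (_ , pᵢ∤r) , small) →
        ≡mod⇒≡ (≡ᵘ-cross (residue-≡ᵘ pᵢ-prime pᵢ∤q)
                          (subst (_≡ᵘ rᵘ mod[ _ ]) (sym φqᵢ≡φrᵢ) (residue-≡ᵘ pᵢ-prime pᵢ∤r))) small

  ≈φ-if-≡ᵘ : ∀ {x u} → In𝔽 x → AlmostAll (λ i → x i ≡ᵘ u mod[ p̂ i ]) → x ≈ φ (fromℚᵘ u)
  ≈φ-if-≡ᵘ {x} {u} x∈𝔽 x≡u =
    upward 𝓕 (inter 𝓕 x∈𝔽 (inter 𝓕 x≡u (inter 𝓕 (prime∤ (↧ₙ u)) (prime∤ (↧ₙ toℚᵘ (fromℚᵘ u))))))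
    λ _ (xᵢ<pᵢ , xᵢ≡u , (pᵢ-prime , pᵢ∤u) , (_ , pᵢ∤q)) →
      sym (residue-unique pᵢ-prime pᵢ∤u pᵢ∤q (ℚᵘP.≃-sym (ℚP.toℚᵘ-fromℚᵘ u)) xᵢ<pᵢ xᵢ≡u)

  ≈φ-if-RepQ : ∀ {x n m} → In𝔽 x → AlmostAll (λ i → RepQ (p̂ i) (x i) n m) → ∃[ q ] x ≈ φ q
  ≈φ-if-RepQ {x} {n} {zero} _ reps =
    ⊥-elim (proper 𝓕 (upward 𝓕 reps λ i → ¬RepQ[0] {x = x i} {n = n}))
  ≈φ-if-RepQ {x} {n} {suc d} x∈𝔽 reps
    with almostAll-⊎ 𝓕 (upward 𝓕 reps λ i → RepQ⇒≡ᵘ {x = x i} {n = n})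
  ... | inj₁ x≡n/m  = fromℚᵘ (mkℚᵘ (+ n) d)   , ≈φ-if-≡ᵘ x∈𝔽 x≡n/m
  ... | inj₂ x≡-n/m = fromℚᵘ (mkℚᵘ (- + n) d) , ≈φ-if-≡ᵘ x∈𝔽 x≡-n/m

  module _ (g : ℕ → ℕ → ℕ) (g-min : ∀ p x → Prime p → x < p → IsMinQ p x (g p x)) where

    standard-if-≈φ : ∀ {x} → ∃[ q ] x ≈ φ q → Standard (fQ g x)
    standard-if-≈φ {x} (q , x≈φq) = bounded⇒standard 𝓕 (∣ ↥ toℚᵘ q ∣ ⊔ ↧ₙ toℚᵘ q)
      (upward 𝓕 (inter 𝓕 x≈φq (prime∤ (↧ₙ toℚᵘ q))) λ i (xᵢ≡φqᵢ , pᵢ-prime , pᵢ∤q) →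
        IsMinQ-≤ (g-min (p̂ i) (x i) pᵢ-prime (subst (_< p̂ i) (sym xᵢ≡φqᵢ) (residue< pᵢ-prime)))
          pᵢ∤q
          (subst (_≡ᵘ toℚᵘ q mod[ p̂ i ]) (sym xᵢ≡φqᵢ) (residue-≡ᵘ pᵢ-prime pᵢ∤q)))

    ≈φ-if-standard : ∀ {x} → In𝔽 x → Standard (fQ g x) → ∃[ q ] x ≈ φ q
    ≈φ-if-standard {x} x∈𝔽 (k , gx≈k) =
      let n , reps-n   = pigeonhole 𝓕 _ (suc k) bounded-reps
          m , reps-n,m = pigeonhole 𝓕 _ (suc k) reps-n
      in  ≈φ-if-RepQ {n = n} {m = m} x∈𝔽 reps-n,m
      where
      bounded-reps : AlmostAll (λ i → ∃[ n ] (n < suc k × ∃[ m ] (m < suc k × RepQ (p̂ i) (x i) n m)))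
      bounded-reps = upward 𝓕 (inter 𝓕 (inter 𝓕 p̂-prime x∈𝔽) gx≈k) λ i ((pᵢ-prime , xᵢ<pᵢ) , gᵢ≡k) →
        IsMinQ⇒bounded-RepQ {x = x i}
          (subst (IsMinQ (p̂ i) (x i)) gᵢ≡k (g-min (p̂ i) (x i) pᵢ-prime xᵢ<pᵢ))

-- Countable incompleteness is what makes nonstandard primes exist.
proposition1p1 :
  {I : Set} (𝓕 : Ultrafilter I) → CountablyIncomplete 𝓕 →
  (p̂ : *ℕ I) → Ultrapower.NonstandardPrime 𝓕 p̂ →
  (g : ℕ → ℕ → ℕ) → (∀ p x → Prime p → x < p → IsMinQ p x (g p x)) →
  let open Ultrapower 𝓕
      open PrimeField 𝓕 p̂
  in Σ (ℚ → *ℕ I) λ φ →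
       (∀ q → In𝔽 (φ q)) ×
       (φ ℚ.0ℚ ≈ 0𝔽) × (φ ℚ.1ℚ ≈ 1𝔽) ×
       (∀ q r → φ (q ℚ.+ r) ≈ (φ q +𝔽 φ r)) ×
       (∀ q r → φ (q ℚ.* r) ≈ (φ q *𝔽 φ r)) ×
       (∀ q r → φ q ≈ φ r → q ≡ r) ×
       (∀ x → In𝔽 x → (Standard (fQ g x) ⇔ (∃[ q ] (x ≈ φ q))))
proposition1p1 𝓕 _ p̂ (p̂-prime , p̂-nonstandard) g g-min =
  φ , φ-∈𝔽 , φ-0 , φ-1 , φ-+ , φ-* , φ-injective ,
  λ x x∈𝔽 → mk⇔ (≈φ-if-standard g g-min x∈𝔽) (standard-if-≈φ g g-min)
  where open Embedding 𝓕 p̂ p̂-prime p̂-nonstandard
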